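{- Let $\mathcal T\in\{\mathcal T_{\rm CDV},\mathcal T_{\rm BCD}\}$. If $B\vdash^{\mathcal T}_{=_{\beta\eta}}\Delta_1:\sigma$ and $\Delta_1\to_\eta\Delta_2$, then $B\vdash^{\mathcal T}_{=_{\beta\eta}}\Delta_2:\sigma$.
   Context: Types: $\mathbb A_\infty=\{a_i\mid i\in\mathbb N\}$, $\omega$ special atom, $\mathbb A^\omega_\infty=\mathbb A_\infty\cup\{\omega\}$; types $\sigma::=\mathbb A\mid\sigma\to\sigma\mid\sigma\cap\sigma$. Minimal type theory: (refl), (incl) $\sigma\cap\tau\le\sigma,\sigma\cap\tau\le\tau$, (glb) $\rho\le\sigma,\rho\le\tau\Rightarrow\rho\le\sigma\cap\tau$, (trans). $\mathcal T_{\rm CDV}$: smallest theory over $\mathbb A_\infty$ containing the minimal rules plus $(\to)$ $\sigma_2\le\sigma_1,\tau_1\le\tau_2\Rightarrow\sigma_1\to\tau_1\le\sigma_2\to\tau_2$ and $(\to\cap)$ $(\sigma\to\tau)\cap(\sigma\to\rho)\le\sigma\to\tau\cap\rho$; $\mathcal T_{\rm BCD}$: over $\mathbb A^\omega_\infty$, plus $(\to),(\to\cap)$, $(\omega_{top})$ $\sigma\le\omega$, $(\omega_\to)$ $\omega\le\sigma\to\omega$. $\Delta$-terms: $\Delta::=u_\Delta\mid x\mid\lambda x{:}\sigma.\Delta\mid\Delta\,\Delta\mid\langle\Delta,\Delta\rangle\mid pr_i\Delta\mid\Delta^\sigma$, $u_\Delta$ a constant indexed by an arbitrary $\Delta$-term.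 Essence: $\lfloor x\rfloor=x$, $\lfloor u_\Delta\rfloor=\lfloor\Delta\rfloor$, $\lfloor\Delta^\sigma\rfloor=\lfloor\Delta\rfloor$, $\lfloor\lambda x{:}\sigma.\Delta\rfloor=\lambda x.\lfloor\Delta\rfloor$, $\lfloor\Delta_1\Delta_2\rfloor=\lfloor\Delta_1\rfloor\lfloor\Delta_2\rfloor$, $\lfloor\langle\Delta_1,\Delta_2\rangle\rfloor=\lfloor\Delta_1\rfloor$, $\lfloor pr_i\Delta\rfloor=\lfloor\Delta\rfloor$. Typed system $\Delta^{\mathcal T}_{=_{\beta\eta}}$: (top) $B\vdash u_\Delta:\omega$ if $\omega$ is an atom of $\mathcal T$; (ax) $B\vdash x:\sigma$ if $x{:}\sigma\in B$; ($\to I$) $B,x{:}\sigma\vdash\Delta:\tau\Rightarrow B\vdash\lambda x{:}\sigma.\Delta:\sigma\to\tau$; ($\to E$) from $\Delta_1:\sigma\to\tau$, $\Delta_2:\sigma$ get $\Delta_1\Delta_2:\tau$; ($\cap I$) from $B\vdash\Delta_1:\sigma$, $B\vdash\Delta_2:\tau$, $\lfloor\Delta_1\rfloor=_{\beta\eta}\lfloor\Delta_2\rfloor$ get $B\vdash\langle\Delta_1,\Delta_2\rangle:\sigma\cap\tau$; ($\cap E_i$) from $\Delta:\sigma\cap\tau$ get $pr_1\Delta:\sigma$, $pr_2\Delta:\tau$; ($\le_{\mathcal T}$) from $\Delta:\sigma$ and $\sigma\le_{\mathcal T}\tau$ get $\Delta^\tau:\tau$. $\to_\eta$ is the contextual closure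 (no reduction inside the index of $u_\Delta$) of $(\eta)$: $\lambda x{:}\sigma.\Delta\,x\to\Delta$ if $x\notin{\rm FV}(\Delta)$. -}

module Defs where

open import Data.Nat using (ℕ; zero; suc)
open import Data.List using (List; []; _∷_)
open import Relation.Binary.Construct.Closure.Equivalence using (EqClosure)

data Theory : Set where
  CDV BCD : Theory

-- Intersection types over the atoms of the theory.
-- a i  is the atom a_i ∈ A_∞; ω exists only for BCD.
data Ty : Theory → Set where
  a   : ∀ {T} → ℕ → Ty T
  ω   : Ty BCD
  _⇒_ : ∀ {T} → Ty T → Ty T → Ty T
  _∩_ : ∀ {T} → Ty T → Ty T → Ty T

infixr 7 _⇒_
infixl 8 _∩_

data _≤_ : ∀ {T} → Ty T → Ty T → Set where
  refl≤  : ∀ {T} {σ : Ty T} → σ ≤ σ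
  inclˡ  : ∀ {T} {σ τ : Ty T} → (σ ∩ τ) ≤ σ
  inclʳ  : ∀ {T} {σ τ : Ty T} → (σ ∩ τ) ≤ τ
  glb    : ∀ {T} {ρ σ τ : Ty T} → ρ ≤ σ → ρ ≤ τ → ρ ≤ (σ ∩ τ)
  trans≤ : ∀ {T} {σ τ ρ : Ty T} → σ ≤ τ → τ ≤ ρ → σ ≤ ρ
  arr    : ∀ {T} {σ₁ σ₂ τ₁ τ₂ : Ty T} → σ₂ ≤ σ₁ → τ₁ ≤ τ₂ → (σ₁ ⇒ τ₁) ≤ (σ₂ ⇒ τ₂)
  arr∩   : ∀ {T} {σ τ ρ : Ty T} → ((σ ⇒ τ) ∩ (σ ⇒ ρ)) ≤ (σ ⇒ (τ ∩ ρ))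
  ωtop   : {σ : Ty BCD} → σ ≤ ω
  ω⇒     : {σ : Ty BCD} → ω ≤ (σ ⇒ ω)

data Λ : Set where
  var : ℕ → Λ
  lam : Λ → Λ
  app : Λ → Λ → Λ

extᴿ : (ℕ → ℕ) → ℕ → ℕ
extᴿ ρ zero    = zero
extᴿ ρ (suc n) = suc (ρ n)

renΛ : (ℕ → ℕ) → Λ → Λ
renΛ ρ (var x)   = var (ρ x)
renΛ ρ (lam M)   = lam (renΛ (extᴿ ρ) M)
renΛ ρ (app M N) = app (renΛ ρ M) (renΛ ρ N)

extˢ : (ℕ → Λ) → ℕ → Λ
extˢ s zero    = var zero
extˢ s (suc n) = renΛ suc (s n)

subΛ : (ℕ → Λ) → Λ → Λ
subΛ s (var x)   = s x
subΛ s (lam M)   = lam (subΛ (extˢ s) M)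
subΛ s (app M N) = app (subΛ s M) (subΛ s N)

single : Λ → ℕ → Λ
single N zero    = N
single N (suc n) = var n

_[_] : Λ → Λ → Λ
M [ N ] = subΛ (single N) M

data _⟶βη_ : Λ → Λ → Set where
  β     : ∀ {M N} → app (lam M) N ⟶βη (M [ N ])
  η     : ∀ {M} → lam (app (renΛ suc M) (var zero)) ⟶βη M
  ξlam  : ∀ {M M'} → M ⟶βη M' → lam M ⟶βη lam M'
  ξappˡ : ∀ {M M' N} → M ⟶βη M' → app M N ⟶βη app M' N
  ξappʳ : ∀ {M N N'} → N ⟶βη N' → app M N ⟶βη app M N'

_=βη_ : Λ → Λ → Set
_=βη_ = EqClosure _⟶βη_

data Tm (T : Theory) : Set where
  u     : Tm T → Tm T
  var   : ℕ → Tm T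
  lam   : Ty T → Tm T → Tm T
  app   : Tm T → Tm T → Tm T
  ⟨_,_⟩ : Tm T → Tm T → Tm T
  pr₁   : Tm T → Tm T
  pr₂   : Tm T → Tm T
  _^_   : Tm T → Ty T → Tm T

⌊_⌋ : ∀ {T} → Tm T → Λ
⌊ u Δ ⌋       = ⌊ Δ ⌋
⌊ var x ⌋     = var x
⌊ lam σ Δ ⌋   = lam ⌊ Δ ⌋
⌊ app Δ Δ' ⌋  = app ⌊ Δ ⌋ ⌊ Δ' ⌋
⌊ ⟨ Δ , Δ' ⟩ ⌋ = ⌊ Δ ⌋
⌊ pr₁ Δ ⌋     = ⌊ Δ ⌋
⌊ pr₂ Δ ⌋     = ⌊ Δ ⌋
⌊ Δ ^ σ ⌋     = ⌊ Δ ⌋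

-- Renaming of Δ-terms (acts everywhere, including inside u-indices,
-- since FV(u_Δ) = FV(Δ)).
ren : ∀ {T} → (ℕ → ℕ) → Tm T → Tm T
ren ρ (u Δ)       = u (ren ρ Δ)
ren ρ (var x)     = var (ρ x)
ren ρ (lam σ Δ)   = lam σ (ren (extᴿ ρ) Δ)
ren ρ (app Δ Δ')  = app (ren ρ Δ) (ren ρ Δ')
ren ρ ⟨ Δ , Δ' ⟩  = ⟨ ren ρ Δ , ren ρ Δ' ⟩
ren ρ (pr₁ Δ)     = pr₁ (ren ρ Δ)
ren ρ (pr₂ Δ)     = pr₂ (ren ρ Δ)
ren ρ (Δ ^ σ)     = ren ρ Δ ^ σ

-- η-reduction on Δ-terms: contextual closure of
--   λx:σ. Δ x → Δ  (x ∉ FV(Δ)),  i.e. in de Bruijn: λσ.(↑Δ) 0 → Δ,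
-- with no reduction inside the index of u_Δ.
data _→η_ {T : Theory} : Tm T → Tm T → Set where
  η     : ∀ {σ Δ} → lam σ (app (ren suc Δ) (var zero)) →η Δ
  ξlam  : ∀ {σ Δ Δ'} → Δ →η Δ' → lam σ Δ →η lam σ Δ'
  ξappˡ : ∀ {Δ Δ' Θ} → Δ →η Δ' → app Δ Θ →η app Δ' Θ
  ξappʳ : ∀ {Δ Θ Θ'} → Θ →η Θ' → app Δ Θ →η app Δ Θ'
  ξpairˡ : ∀ {Δ Δ' Θ} → Δ →η Δ' → ⟨ Δ , Θ ⟩ →η ⟨ Δ' , Θ ⟩
  ξpairʳ : ∀ {Δ Θ Θ'} → Θ →η Θ' → ⟨ Δ , Θ ⟩ →η ⟨ Δ , Θ' ⟩
  ξpr₁  : ∀ {Δ Δ'} → Δ →η Δ' → pr₁ Δ →η pr₁ Δ'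
  ξpr₂  : ∀ {Δ Δ'} → Δ →η Δ' → pr₂ Δ →η pr₂ Δ'
  ξ^    : ∀ {Δ Δ' σ} → Δ →η Δ' → (Δ ^ σ) →η (Δ' ^ σ)

Ctx : Theory → Set
Ctx T = List (Ty T)

data _∋_∶_ {T : Theory} : Ctx T → ℕ → Ty T → Set where
  here  : ∀ {B σ} → (σ ∷ B) ∋ zero ∶ σ
  there : ∀ {B σ τ x} → B ∋ x ∶ σ → (τ ∷ B) ∋ suc x ∶ σ

data _⊢_∶_ : ∀ {T} → Ctx T → Tm T → Ty T → Set where
  top : ∀ {B : Ctx BCD} {Δ} → B ⊢ u Δ ∶ ω
  ax  : ∀ {T} {B : Ctx T} {x σ} → B ∋ x ∶ σ → B ⊢ var x ∶ σ
  →I  : ∀ {T} {B : Ctx T} {σ τ Δ} → (σ ∷ B) ⊢ Δ ∶ τ → B ⊢ lam σ Δ ∶ (σ ⇒ τ)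
  →E  : ∀ {T} {B : Ctx T} {σ τ Δ₁ Δ₂} →
        B ⊢ Δ₁ ∶ (σ ⇒ τ) → B ⊢ Δ₂ ∶ σ → B ⊢ app Δ₁ Δ₂ ∶ τ
  ∩I  : ∀ {T} {B : Ctx T} {σ τ Δ₁ Δ₂} →
        B ⊢ Δ₁ ∶ σ → B ⊢ Δ₂ ∶ τ → ⌊ Δ₁ ⌋ =βη ⌊ Δ₂ ⌋ → B ⊢ ⟨ Δ₁ , Δ₂ ⟩ ∶ (σ ∩ τ)
  ∩E₁ : ∀ {T} {B : Ctx T} {σ τ Δ} → B ⊢ Δ ∶ (σ ∩ τ) → B ⊢ pr₁ Δ ∶ σ
  ∩E₂ : ∀ {T} {B : Ctx T} {σ τ Δ} → B ⊢ Δ ∶ (σ ∩ τ) → B ⊢ pr₂ Δ ∶ τ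
  ≤T  : ∀ {T} {B : Ctx T} {σ τ Δ} → B ⊢ Δ ∶ σ → σ ≤ τ → B ⊢ (Δ ^ τ) ∶ τ

-- Subject reduction for η holds because every step other than contracting the
-- η-redex itself is a congruence, and the side condition of (∩I) survives it:
-- an η-step on a Δ-term is a βη-step (or nothing) on its essence. For the redex
-- λx:σ.Δ x the typing rules leave no choice: Δ must have type σ → τ under B, x:σ,
-- where x is fresh, so it remains to strengthen the basis. Strengthening passes
-- through (∩I) because renaming preserves βη-conversion and the shift suc has
-- the left inverse pred, so renaming by suc also reflects it.
module Submission where

open import Defs
open import Data.Nat using (ℕ; zero; suc; pred)
open import Data.List using (_∷_)
open import Function.Base using (_∘_)
open import Relation.Binary.PropositionalEquality
  using (_≡_; refl; sym; trans; cong; cong₂; subst; subst₂; module ≡-Reasoning)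
open import Relation.Binary.Construct.Closure.Equivalence using (gmap; return; symmetric)
open import Relation.Binary.Construct.Closure.ReflexiveTransitive using (ε; _◅◅_)

renΛ-cong : ∀ {ρ ρ′} → (∀ x → ρ x ≡ ρ′ x) → ∀ M → renΛ ρ M ≡ renΛ ρ′ M
renΛ-cong h (var x)   = cong var (h x)
renΛ-cong h (lam M)   = cong lam (renΛ-cong h′ M)
  where
  h′ : ∀ x → extᴿ _ x ≡ extᴿ _ x
  h′ zero    = refl
  h′ (suc x) = cong suc (h x)
renΛ-cong h (app M N) = cong₂ app (renΛ-cong h M) (renΛ-cong h N)

subΛ-cong : ∀ {s s′} → (∀ x → s x ≡ s′ x) → ∀ M → subΛ s M ≡ subΛ s′ M
subΛ-cong h (var x)   = h x
subΛ-cong h (lam M)   = cong lam (subΛ-cong h′ M)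
  where
  h′ : ∀ x → extˢ _ x ≡ extˢ _ x
  h′ zero    = refl
  h′ (suc x) = cong (renΛ suc) (h x)
subΛ-cong h (app M N) = cong₂ app (subΛ-cong h M) (subΛ-cong h N)

renΛ-id : ∀ {ρ} → (∀ x → ρ x ≡ x) → ∀ M → renΛ ρ M ≡ M
renΛ-id h (var x)   = cong var (h x)
renΛ-id h (lam M)   = cong lam (renΛ-id h′ M)
  where
  h′ : ∀ x → extᴿ _ x ≡ x
  h′ zero    = refl
  h′ (suc x) = cong suc (h x)
renΛ-id h (app M N) = cong₂ app (renΛ-id h M) (renΛ-id h N)

renΛ-∘ : ∀ ρ ρ′ M → renΛ ρ (renΛ ρ′ M) ≡ renΛ (ρ ∘ ρ′) M
renΛ-∘ ρ ρ′ (var x)   = refl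
renΛ-∘ ρ ρ′ (lam M)   =
  cong lam (trans (renΛ-∘ (extᴿ ρ) (extᴿ ρ′) M) (renΛ-cong extᴿ-∘ M))
  where
  extᴿ-∘ : ∀ x → extᴿ ρ (extᴿ ρ′ x) ≡ extᴿ (ρ ∘ ρ′) x
  extᴿ-∘ zero    = refl
  extᴿ-∘ (suc x) = refl
renΛ-∘ ρ ρ′ (app M N) = cong₂ app (renΛ-∘ ρ ρ′ M) (renΛ-∘ ρ ρ′ N)

renΛ-extᴿ-suc : ∀ ρ M → renΛ (extᴿ ρ) (renΛ suc M) ≡ renΛ suc (renΛ ρ M)
renΛ-extᴿ-suc ρ M = trans (renΛ-∘ (extᴿ ρ) suc M) (sym (renΛ-∘ suc ρ M))

subΛ-renΛ : ∀ s ρ M → subΛ s (renΛ ρ M) ≡ subΛ (s ∘ ρ) M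
subΛ-renΛ s ρ (var x)   = refl
subΛ-renΛ s ρ (lam M)   =
  cong lam (trans (subΛ-renΛ (extˢ s) (extᴿ ρ) M) (subΛ-cong extˢ-extᴿ M))
  where
  extˢ-extᴿ : ∀ x → extˢ s (extᴿ ρ x) ≡ extˢ (s ∘ ρ) x
  extˢ-extᴿ zero    = refl
  extˢ-extᴿ (suc x) = refl
subΛ-renΛ s ρ (app M N) = cong₂ app (subΛ-renΛ s ρ M) (subΛ-renΛ s ρ N)

renΛ-subΛ : ∀ ρ s M → renΛ ρ (subΛ s M) ≡ subΛ (renΛ ρ ∘ s) M
renΛ-subΛ ρ s (var x)   = refl
renΛ-subΛ ρ s (lam M)   =
  cong lam (trans (renΛ-subΛ (extᴿ ρ) (extˢ s) M) (subΛ-cong extᴿ-extˢ M))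
  where
  extᴿ-extˢ : ∀ x → renΛ (extᴿ ρ) (extˢ s x) ≡ extˢ (renΛ ρ ∘ s) x
  extᴿ-extˢ zero    = refl
  extᴿ-extˢ (suc x) = renΛ-extᴿ-suc ρ (s x)
renΛ-subΛ ρ s (app M N) = cong₂ app (renΛ-subΛ ρ s M) (renΛ-subΛ ρ s N)

renΛ-[] : ∀ ρ M N → renΛ ρ (M [ N ]) ≡ renΛ (extᴿ ρ) M [ renΛ ρ N ]
renΛ-[] ρ M N = begin
  renΛ ρ (subΛ (single N) M)                      ≡⟨ renΛ-subΛ ρ (single N) M ⟩
  subΛ (renΛ ρ ∘ single N) M                      ≡⟨ subΛ-cong single-extᴿ M ⟩
  subΛ (single (renΛ ρ N) ∘ extᴿ ρ) M             ≡⟨ subΛ-renΛ (single (renΛ ρ N)) (extᴿ ρ) M ⟨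
  subΛ (single (renΛ ρ N)) (renΛ (extᴿ ρ) M)      ∎
  where
  open ≡-Reasoning
  single-extᴿ : ∀ x → renΛ ρ (single N x) ≡ single (renΛ ρ N) (extᴿ ρ x)
  single-extᴿ zero    = refl
  single-extᴿ (suc x) = refl

renΛ-⟶βη : ∀ ρ {M N} → M ⟶βη N → renΛ ρ M ⟶βη renΛ ρ N
renΛ-⟶βη ρ (β {M} {N}) =
  subst (app (lam (renΛ (extᴿ ρ) M)) (renΛ ρ N) ⟶βη_) (sym (renΛ-[] ρ M N)) β
renΛ-⟶βη ρ (η {M}) =
  subst (λ L → lam (app L (var zero)) ⟶βη renΛ ρ M) (sym (renΛ-extᴿ-suc ρ M)) η
renΛ-⟶βη ρ (ξlam r)  = ξlam (renΛ-⟶βη (extᴿ ρ) r)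
renΛ-⟶βη ρ (ξappˡ r) = ξappˡ (renΛ-⟶βη ρ r)
renΛ-⟶βη ρ (ξappʳ r) = ξappʳ (renΛ-⟶βη ρ r)

renΛ-=βη : ∀ ρ {M N} → M =βη N → renΛ ρ M =βη renΛ ρ N
renΛ-=βη ρ = gmap (renΛ ρ) (renΛ-⟶βη ρ)

renΛ-reflects-=βη : ∀ {ρ ρ⁻¹} → (∀ x → ρ⁻¹ (ρ x) ≡ x) →
  ∀ {M N} → renΛ ρ M =βη renΛ ρ N → M =βη N
renΛ-reflects-=βη {ρ} {ρ⁻¹} inverse {M} {N} e =
  subst₂ _=βη_ (retract M) (retract N) (renΛ-=βη ρ⁻¹ e)
  where
  retract : ∀ L → renΛ ρ⁻¹ (renΛ ρ L) ≡ L
  retract L = trans (renΛ-∘ ρ⁻¹ ρ L) (renΛ-id inverse L)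

⌊⌋-ren : ∀ {T} ρ (Δ : Tm T) → ⌊ ren ρ Δ ⌋ ≡ renΛ ρ ⌊ Δ ⌋
⌊⌋-ren ρ (u Δ)       = ⌊⌋-ren ρ Δ
⌊⌋-ren ρ (var x)     = refl
⌊⌋-ren ρ (lam σ Δ)   = cong lam (⌊⌋-ren (extᴿ ρ) Δ)
⌊⌋-ren ρ (app Δ Δ′)  = cong₂ app (⌊⌋-ren ρ Δ) (⌊⌋-ren ρ Δ′)
⌊⌋-ren ρ ⟨ Δ , Δ′ ⟩  = ⌊⌋-ren ρ Δ
⌊⌋-ren ρ (pr₁ Δ)     = ⌊⌋-ren ρ Δ
⌊⌋-ren ρ (pr₂ Δ)     = ⌊⌋-ren ρ Δ
⌊⌋-ren ρ (Δ ^ σ)     = ⌊⌋-ren ρ Δ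

⌊⌋-→η : ∀ {T} {Δ Δ′ : Tm T} → Δ →η Δ′ → ⌊ Δ ⌋ =βη ⌊ Δ′ ⌋
⌊⌋-→η (η {Δ = Δ}) =
  subst (λ L → lam (app L (var zero)) =βη ⌊ Δ ⌋) (sym (⌊⌋-ren suc Δ)) (return η)
⌊⌋-→η (ξlam r)   = gmap lam ξlam (⌊⌋-→η r)
⌊⌋-→η (ξappˡ r)  = gmap (λ L → app L _) ξappˡ (⌊⌋-→η r)
⌊⌋-→η (ξappʳ r)  = gmap (app _) ξappʳ (⌊⌋-→η r)
⌊⌋-→η (ξpairˡ r) = ⌊⌋-→η r
⌊⌋-→η (ξpairʳ r) = ε
⌊⌋-→η (ξpr₁ r)   = ⌊⌋-→η r
⌊⌋-→η (ξpr₂ r)   = ⌊⌋-→η r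
⌊⌋-→η (ξ^ r)     = ⌊⌋-→η r

strengthen : ∀ {T} {B B′ : Ctx T} (ρ ρ⁻¹ : ℕ → ℕ) → (∀ x → ρ⁻¹ (ρ x) ≡ x) →
  (∀ {x τ} → B′ ∋ ρ x ∶ τ → B ∋ x ∶ τ) →
  ∀ Δ {θ} → B′ ⊢ ren ρ Δ ∶ θ → B ⊢ Δ ∶ θ
strengthen {B = B} {B′} ρ ρ⁻¹ inverse lookup = go
  where
  go : ∀ Δ {θ} → B′ ⊢ ren ρ Δ ∶ θ → B ⊢ Δ ∶ θ
  go (u Δ)      top         = top
  go (var x)    (ax p)      = ax (lookup p)
  go (lam σ Δ)  (→I D)      = →I (strengthen (extᴿ ρ) (extᴿ ρ⁻¹) inverse′ lookup′ Δ D)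
    where
    inverse′ : ∀ x → extᴿ ρ⁻¹ (extᴿ ρ x) ≡ x
    inverse′ zero    = refl
    inverse′ (suc x) = cong suc (inverse x)
    lookup′ : ∀ {x τ} → (σ ∷ B′) ∋ extᴿ ρ x ∶ τ → (σ ∷ B) ∋ x ∶ τ
    lookup′ {zero}  here      = here
    lookup′ {suc x} (there p) = there (lookup p)
  go (app Δ Δ′) (→E D D′)   = →E (go Δ D) (go Δ′ D′)
  go ⟨ Δ , Δ′ ⟩ (∩I D D′ e) =
    ∩I (go Δ D) (go Δ′ D′)
       (renΛ-reflects-=βη {ρ⁻¹ = ρ⁻¹} inverse (subst₂ _=βη_ (⌊⌋-ren ρ Δ) (⌊⌋-ren ρ Δ′) e))
  go (pr₁ Δ)    (∩E₁ D)     = ∩E₁ (go Δ D)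
  go (pr₂ Δ)    (∩E₂ D)     = ∩E₂ (go Δ D)
  go (Δ ^ σ)    (≤T D le)   = ≤T (go Δ D) le

strengthen-fresh : ∀ {T} {B : Ctx T} {σ} Δ {θ} → (σ ∷ B) ⊢ ren suc Δ ∶ θ → B ⊢ Δ ∶ θ
strengthen-fresh = strengthen suc pred (λ _ → refl) (λ { (there p) → p })

theorem4p7 : (T : Theory) {B : Ctx T} {Δ₁ Δ₂ : Tm T} {σ : Ty T} →
    B ⊢ Δ₁ ∶ σ → Δ₁ →η Δ₂ → B ⊢ Δ₂ ∶ σ
theorem4p7 T (→I (→E D (ax here))) (η {Δ = Δ}) = strengthen-fresh Δ D
theorem4p7 T (→I D)      (ξlam r)   = →I (theorem4p7 T D r)
theorem4p7 T (→E D D′)   (ξappˡ r)  = →E (theorem4p7 T D r) D′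
theorem4p7 T (→E D D′)   (ξappʳ r)  = →E D (theorem4p7 T D′ r)
theorem4p7 T (∩I D D′ e) (ξpairˡ r) =
  ∩I (theorem4p7 T D r) D′ (symmetric _⟶βη_ (⌊⌋-→η r) ◅◅ e)
theorem4p7 T (∩I D D′ e) (ξpairʳ r) = ∩I D (theorem4p7 T D′ r) (e ◅◅ ⌊⌋-→η r)
theorem4p7 T (∩E₁ D)     (ξpr₁ r)   = ∩E₁ (theorem4p7 T D r)
theorem4p7 T (∩E₂ D)     (ξpr₂ r)   = ∩E₂ (theorem4p7 T D r)
theorem4p7 T (≤T D le)   (ξ^ r)     = ≤T (theorem4p7 T D r) le
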